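{- For every graph $G$, $\mathrm{core}(G)\cap L^c(G)=\mathrm{core}(L_G^c)$ and $\mathrm{corona}(G)\cap L^c(G)=\mathrm{corona}(L_G^c)$.
   Context: All graphs are finite, simple and undirected. $\alpha(H)$ is the maximum size of an independent set of $H$; $\Omega(H)$ is the family of maximum independent sets of $H$; $\mathrm{core}(H)=\bigcap_{S\in\Omega(H)}S$ and $\mathrm{corona}(H)=\bigcup_{S\in\Omega(H)}S$ (for the graph with no vertices, core and corona are empty). For $S\subseteq V(G)$, $N(S)$ is the set of vertices adjacent to some vertex of $S$. An independent set $I$ is critical if $|I|-|N(I)|=\max\{|J|-|N(J)|:J\subseteq V(G)\}$; a maximum critical independent set is a critical independent set of maximum cardinality. Larson's set $L(G)$ is defined as $L(G)=J\cup N(J)$ for a maximum critical independent set $J$ of $G$ (this is known to be independent of the choice of $J$). Let $L^c(G)=V(G)\setminus L(G)$ and $L_G^c=G[L^c(G)]$. -}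

module Defs where

open import Data.Nat using (ℕ; _≤_)
open import Data.Integer as ℤ using (ℤ; +_)
open import Data.Bool using (Bool; true; false; _∧_)
open import Data.Fin using (Fin)
open import Data.List using (allFin)
open import Data.Bool.ListAction using (any)
open import Data.Vec using (tabulate; lookup)
open import Data.Fin.Subset using (Subset; _∈_; _∉_; _⊆_; ∣_∣; _∪_; ∁; ⊤)
open import Data.Product using (_×_; ∃-syntax)
open import Relation.Binary.PropositionalEquality using (_≡_)

record Graph : Set where
  field
    n      : ℕ
    adj    : Fin n → Fin n → Bool
    sym    : ∀ x y → adj x y ≡ adj y x
    irrefl : ∀ x → adj x x ≡ false
open Graph public

-- Induced subgraphs G[U] are represented by the vertex subset U ⊆ V(G),
-- keeping the original vertex labels (G itself is G[⊤]).

Independent : (G : Graph) → Subset (n G) → Subset (n G) → Set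
Independent G U S = (S ⊆ U) × (∀ x y → x ∈ S → y ∈ S → adj G x y ≡ false)

MaxIndependent : (G : Graph) → Subset (n G) → Subset (n G) → Set
MaxIndependent G U S =
  Independent G U S × (∀ T → Independent G U T → ∣ T ∣ ≤ ∣ S ∣)

InCore : (G : Graph) → Subset (n G) → Fin (n G) → Set
InCore G U x = ∀ S → MaxIndependent G U S → x ∈ S

InCorona : (G : Graph) → Subset (n G) → Fin (n G) → Set
InCorona G U x = ∃[ S ] (MaxIndependent G U S × x ∈ S)

N : (G : Graph) → Subset (n G) → Subset (n G)
N G S = tabulate (λ x → any (λ y → lookup S y ∧ adj G x y) (allFin (n G)))

diff : (G : Graph) → Subset (n G) → ℤ
diff G S = + ∣ S ∣ ℤ.- + ∣ N G S ∣

CriticalIndependent : (G : Graph) → Subset (n G) → Set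
CriticalIndependent G I =
  Independent G ⊤ I × (∀ J → diff G J ℤ.≤ diff G I)

MaxCriticalIndependent : (G : Graph) → Subset (n G) → Set
MaxCriticalIndependent G I =
  CriticalIndependent G I × (∀ I' → CriticalIndependent G I' → ∣ I' ∣ ≤ ∣ I ∣)

-- L(G) computed from a (maximum critical independent) set J, and its complement
Lset : (G : Graph) → Subset (n G) → Subset (n G)
Lset G J = J ∪ N G J

Lc : (G : Graph) → Subset (n G) → Subset (n G)
Lc G J = ∁ (Lset G J)

{-# OPTIONS --safe #-}
-- Since J is critical, every independent set S of G meets L = J ∪ N(J) in at
-- most |J| vertices.  Indeed, with A = S ∩ N(J) and J′ = J ∖ N(A), the sets
-- N(J′) and A are disjoint inside N(J), so |J′| - |N(J′)| ≤ |J| - |N(J)| forces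
-- |A| ≤ |J ∩ N(A)|; and J ∩ N(A) misses S because S is independent.
-- Conversely, J ∪ T is independent for every independent set T of G[Lᶜ], as
-- no vertex of Lᶜ has a neighbour in J.  Hence α(G) = |J| + α(G[Lᶜ]), so
-- S ↦ S ∩ Lᶜ maps Ω(G) into Ω(G[Lᶜ]) and T ↦ J ∪ T maps Ω(G[Lᶜ]) into Ω(G),
-- which yields both equalities.
module Submission where

open import Defs
open import Data.Fin.Subset using (Subset; _∈_; ⊤)
open import Data.Product using (_×_)
open import Function.Bundles using (_⇔_; mk⇔)

open import Level using (Level)
open import Data.Bool using (true; false; T; _≟_)
open import Data.Bool.Properties using (T-≡; T-∧; ¬-not; not-¬)
open import Data.Fin.Properties using (all?)
open import Data.Fin.Subset
  using (_∉_; _⊆_; _∩_; _∪_; ∁; ⊥; ∣_∣; Empty; inside; outside)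
open import Data.Fin.Subset.Properties
  using ( _∈?_; _⊆?_; ∈⊤; ∉⊥; ⊥⊆; Empty-unique; ∣⊥∣≡0; ∣p∣≤n; p⊆q⇒∣p∣≤∣q∣; anySubset?
        ; p∩q⊆p; p∩q⊆q; x∈p∩q⁺; x∈p∩q⁻; p⊆p∪q; q⊆p∪q; x∈p∪q⁺; x∈p∪q⁻
        ; x∈∁p⇒x∉p; ∩-distribˡ-∪ )
open import Data.Integer as ℤ using (+_)
open import Data.Integer.Properties using (drop‿+≤+; pos-+)
import Data.Integer.Properties as ℤ
open import Data.Integer.Tactic.RingSolver using (solve-∀)
open import Data.List using (allFin)
open import Data.List.Membership.Propositional using (lose)
open import Data.List.Membership.Propositional.Properties using (∈-allFin)
open import Data.List.Relation.Unary.Any using (satisfied)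
open import Data.List.Relation.Unary.Any.Properties using (any⁺; any⁻)
open import Data.Nat using (ℕ; zero; suc; _+_; _≤_; _<?_)
open import Data.Nat.Properties
  using ( +-suc; +-assoc; +-comm; +-identityʳ; m≤m+n; ≤-trans; ≤-reflexive; ≮⇒≥
        ; +-monoˡ-≤; +-monoʳ-≤; +-cancelˡ-≤; module ≤-Reasoning )
open import Data.Product using (∃-syntax; _,_; proj₁; proj₂)
open import Data.Sum using (_⊎_; inj₁; inj₂; [_,_]′)
open import Data.Vec using (_∷_; []; lookup)
open import Data.Vec.Properties using (lookup∘tabulate; []=⇒lookup; lookup⇒[]=)
open import Function using (id; _∘_)
open import Function.Bundles using (Equivalence)
open import Relation.Nullary using (yes; no; contradiction)
open import Relation.Nullary.Decidable using (_×-dec_; _→-dec_)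
open import Relation.Unary using (Pred; Decidable)
open import Relation.Binary.PropositionalEquality
  using (_≡_; refl; trans; cong; subst)
import Relation.Binary.PropositionalEquality as ≡

open Equivalence using (to; from)

private
  variable
    m : ℕ
    ℓ : Level

∣p∣≡∣p∩q∣+∣p∩∁q∣ : ∀ (p q : Subset m) → ∣ p ∣ ≡ ∣ p ∩ q ∣ + ∣ p ∩ ∁ q ∣
∣p∣≡∣p∩q∣+∣p∩∁q∣ []            []            = refl
∣p∣≡∣p∩q∣+∣p∩∁q∣ (inside  ∷ p) (inside  ∷ q) = cong suc (∣p∣≡∣p∩q∣+∣p∩∁q∣ p q)
∣p∣≡∣p∩q∣+∣p∩∁q∣ (inside  ∷ p) (outside ∷ q) =
  trans (cong suc (∣p∣≡∣p∩q∣+∣p∩∁q∣ p q)) (≡.sym (+-suc _ _))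
∣p∣≡∣p∩q∣+∣p∩∁q∣ (outside ∷ p) (_       ∷ q) = ∣p∣≡∣p∩q∣+∣p∩∁q∣ p q

∣p∪q∣+∣p∩q∣≡∣p∣+∣q∣ : ∀ (p q : Subset m) → ∣ p ∪ q ∣ + ∣ p ∩ q ∣ ≡ ∣ p ∣ + ∣ q ∣
∣p∪q∣+∣p∩q∣≡∣p∣+∣q∣ []            []            = refl
∣p∪q∣+∣p∩q∣≡∣p∣+∣q∣ (inside  ∷ p) (inside  ∷ q) = cong suc (trans (+-suc _ _)
  (trans (cong suc (∣p∪q∣+∣p∩q∣≡∣p∣+∣q∣ p q)) (≡.sym (+-suc _ _))))
∣p∪q∣+∣p∩q∣≡∣p∣+∣q∣ (inside  ∷ p) (outside ∷ q) = cong suc (∣p∪q∣+∣p∩q∣≡∣p∣+∣q∣ p q)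
∣p∪q∣+∣p∩q∣≡∣p∣+∣q∣ (outside ∷ p) (inside  ∷ q) =
  trans (cong suc (∣p∪q∣+∣p∩q∣≡∣p∣+∣q∣ p q)) (≡.sym (+-suc _ _))
∣p∪q∣+∣p∩q∣≡∣p∣+∣q∣ (outside ∷ p) (outside ∷ q) = ∣p∪q∣+∣p∩q∣≡∣p∣+∣q∣ p q

∣p∪q∣≤∣p∣+∣q∣ : ∀ (p q : Subset m) → ∣ p ∪ q ∣ ≤ ∣ p ∣ + ∣ q ∣
∣p∪q∣≤∣p∣+∣q∣ p q = ≤-trans (m≤m+n _ _) (≤-reflexive (∣p∪q∣+∣p∩q∣≡∣p∣+∣q∣ p q))

disjoint⇒∣p∣+∣q∣≤∣r∣ : ∀ {p q r : Subset m} →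
  Empty (p ∩ q) → p ⊆ r → q ⊆ r → ∣ p ∣ + ∣ q ∣ ≤ ∣ r ∣
disjoint⇒∣p∣+∣q∣≤∣r∣ {m} {p} {q} {r} p∩q-empty p⊆r q⊆r = begin
  ∣ p ∣ + ∣ q ∣             ≡⟨ ≡.sym (∣p∪q∣+∣p∩q∣≡∣p∣+∣q∣ p q) ⟩
  ∣ p ∪ q ∣ + ∣ p ∩ q ∣     ≡⟨ cong (_+_ ∣ p ∪ q ∣) ∣p∩q∣≡0 ⟩
  ∣ p ∪ q ∣ + 0             ≡⟨ +-identityʳ _ ⟩
  ∣ p ∪ q ∣                 ≤⟨ p⊆q⇒∣p∣≤∣q∣ p∪q⊆r ⟩
  ∣ r ∣                     ∎
  where
  open ≤-Reasoning
  ∣p∩q∣≡0 : ∣ p ∩ q ∣ ≡ 0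
  ∣p∩q∣≡0 = trans (cong ∣_∣ (Empty-unique p∩q-empty)) (∣⊥∣≡0 m)
  p∪q⊆r : p ∪ q ⊆ r
  p∪q⊆r = [ p⊆r , q⊆r ]′ ∘ x∈p∪q⁻ p q

module _ {P : Pred (Subset m) ℓ} (P? : Decidable P) where

  ∃-largest : ∀ {S} → P S → ∃[ M ] P M × (∀ T → P T → ∣ T ∣ ≤ ∣ M ∣)
  ∃-largest {S} pS = climb m (m≤m+n m ∣ S ∣) pS
    where
    climb : ∀ k {S} → m ≤ k + ∣ S ∣ → P S → ∃[ M ] P M × (∀ T → P T → ∣ T ∣ ≤ ∣ M ∣)
    climb zero    {S} m≤∣S∣ pS = S , pS , λ T _ → ≤-trans (∣p∣≤n T) m≤∣S∣
    climb (suc k) {S} bound pS with anySubset? (λ T → P? T ×-dec (∣ S ∣ <? ∣ T ∣))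
    ... | yes (T , pT , ∣S∣<∣T∣) =
      climb k (≤-trans bound (≤-trans (≤-reflexive (≡.sym (+-suc k _))) (+-monoʳ-≤ k ∣S∣<∣T∣))) pT
    ... | no ∄larger = S , pS , λ T pT → ≮⇒≥ (λ ∣S∣<∣T∣ → ∄larger (T , pT , ∣S∣<∣T∣))

+m-+n≤+o-+p⇒m+p≤o+n : ∀ m n o p → + m ℤ.- + n ℤ.≤ + o ℤ.- + p → m + p ≤ o + n
+m-+n≤+o-+p⇒m+p≤o+n m n o p m-n≤o-p = drop‿+≤+ (begin
  + (m + p)                          ≡⟨ pos-+ m p ⟩
  + m ℤ.+ + p                        ≡⟨ ≡.sym (x-y+[y+z]≡x+z (+ m) (+ n) (+ p)) ⟩
  (+ m ℤ.- + n) ℤ.+ (+ n ℤ.+ + p)    ≤⟨ ℤ.+-monoˡ-≤ (+ n ℤ.+ + p) m-n≤o-p ⟩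
  (+ o ℤ.- + p) ℤ.+ (+ n ℤ.+ + p)    ≡⟨ x-y+[z+y]≡x+z (+ o) (+ p) (+ n) ⟩
  + o ℤ.+ + n                        ≡⟨ ≡.sym (pos-+ o n) ⟩
  + (o + n)                          ∎)
  where
  open ℤ.≤-Reasoning
  x-y+[y+z]≡x+z : ∀ x y z → (x ℤ.- y) ℤ.+ (y ℤ.+ z) ≡ x ℤ.+ z
  x-y+[y+z]≡x+z = solve-∀
  x-y+[z+y]≡x+z : ∀ x y z → (x ℤ.- y) ℤ.+ (z ℤ.+ y) ≡ x ℤ.+ z
  x-y+[z+y]≡x+z = solve-∀

∈⇒T-lookup : ∀ {p : Subset m} {x} → x ∈ p → T (lookup p x)
∈⇒T-lookup x∈p = from T-≡ ([]=⇒lookup x∈p)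

T-lookup⇒∈ : ∀ {p : Subset m} {x} → T (lookup p x) → x ∈ p
T-lookup⇒∈ {p = p} {x} t = lookup⇒[]= x p (to T-≡ t)

module _ (G : Graph) where

  ∈N⁺ : ∀ {S x y} → y ∈ S → adj G x y ≡ true → x ∈ N G S
  ∈N⁺ {S} {x} {y} y∈S xy = T-lookup⇒∈ (subst T (≡.sym (lookup∘tabulate _ x))
    (any⁺ _ (lose (∈-allFin y) (from T-∧ (∈⇒T-lookup y∈S , from T-≡ xy)))))

  ∈N⁻ : ∀ {S x} → x ∈ N G S → ∃[ y ] y ∈ S × adj G x y ≡ true
  ∈N⁻ {S} {x} x∈NS with satisfied (any⁻ _ (allFin (n G))
                          (subst T (lookup∘tabulate _ x) (∈⇒T-lookup x∈NS)))
  ... | y , y∈S∧xy with to T-∧ y∈S∧xy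
  ...   | y∈S , xy = y , T-lookup⇒∈ y∈S , to T-≡ xy

  N-mono : ∀ {S S′} → S ⊆ S′ → N G S ⊆ N G S′
  N-mono S⊆S′ x∈NS with ∈N⁻ x∈NS
  ... | y , y∈S , xy = ∈N⁺ (S⊆S′ y∈S) xy

  independent? : ∀ U → Decidable (Independent G U)
  independent? U S = (S ⊆? U) ×-dec all? λ x → all? λ y →
    (x ∈? S) →-dec ((y ∈? S) →-dec (adj G x y ≟ false))

  ∃-maximumIndependent : ∀ U → ∃[ S ] MaxIndependent G U S
  ∃-maximumIndependent U = ∃-largest (independent? U) {⊥} (⊥⊆ , λ _ _ x∈⊥ → contradiction x∈⊥ ∉⊥)

module Critical (G : Graph) {J : Subset (n G)} (J-critical : CriticalIndependent G J) where

  open ≤-Reasoning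

  ∣S∩Lset∣≤∣J∣ : ∀ {S} → Independent G ⊤ S → ∣ S ∩ Lset G J ∣ ≤ ∣ J ∣
  ∣S∩Lset∣≤∣J∣ {S} (_ , S-independent) = begin
    ∣ S ∩ (J ∪ N G J) ∣   ≡⟨ cong ∣_∣ (∩-distribˡ-∪ S J (N G J)) ⟩
    ∣ S ∩ J ∪ A ∣         ≤⟨ ∣p∪q∣≤∣p∣+∣q∣ (S ∩ J) A ⟩
    ∣ S ∩ J ∣ + ∣ A ∣     ≤⟨ +-monoʳ-≤ (∣ S ∩ J ∣) ∣A∣≤∣X∣ ⟩
    ∣ S ∩ J ∣ + ∣ X ∣     ≤⟨ disjoint⇒∣p∣+∣q∣≤∣r∣ S∩J∩X-empty (p∩q⊆q S J) (p∩q⊆p J (N G A)) ⟩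
    ∣ J ∣                 ∎
    where
    A X J′ : Subset (n G)
    A  = S ∩ N G J
    X  = J ∩ N G A
    J′ = J ∩ ∁ (N G A)

    N[J′]∩A-empty : Empty (N G J′ ∩ A)
    N[J′]∩A-empty (x , x∈N[J′]∩A) with x∈p∩q⁻ (N G J′) A x∈N[J′]∩A
    ... | x∈N[J′] , x∈A with ∈N⁻ G x∈N[J′]
    ...   | y , y∈J′ , xy = x∈∁p⇒x∉p (proj₂ (x∈p∩q⁻ J _ y∈J′))
                              (∈N⁺ G x∈A (trans (Graph.sym G y x) xy))

    S∩J∩X-empty : Empty ((S ∩ J) ∩ X)
    S∩J∩X-empty (x , x∈S∩J∩X) with x∈p∩q⁻ (S ∩ J) X x∈S∩J∩X
    ... | x∈S∩J , x∈X with ∈N⁻ G (proj₂ (x∈p∩q⁻ J _ x∈X))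
    ...   | y , y∈A , xy = contradiction
      (S-independent x y (proj₁ (x∈p∩q⁻ S J x∈S∩J)) (proj₁ (x∈p∩q⁻ S _ y∈A))) (not-¬ xy)

    ∣A∣≤∣X∣ : ∣ A ∣ ≤ ∣ X ∣
    ∣A∣≤∣X∣ = +-cancelˡ-≤ (∣ J′ ∣ + ∣ N G J′ ∣) _ _ (begin
      ∣ J′ ∣ + ∣ N G J′ ∣ + ∣ A ∣    ≡⟨ +-assoc (∣ J′ ∣) _ _ ⟩
      ∣ J′ ∣ + (∣ N G J′ ∣ + ∣ A ∣)  ≤⟨ +-monoʳ-≤ (∣ J′ ∣) (disjoint⇒∣p∣+∣q∣≤∣r∣ N[J′]∩A-empty
                                          (N-mono G (p∩q⊆p J _)) (p∩q⊆q S (N G J))) ⟩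
      ∣ J′ ∣ + ∣ N G J ∣             ≤⟨ +m-+n≤+o-+p⇒m+p≤o+n (∣ J′ ∣) (∣ N G J′ ∣) (∣ J ∣) (∣ N G J ∣)
                                          (proj₂ J-critical J′) ⟩
      ∣ J ∣ + ∣ N G J′ ∣             ≡⟨ cong (_+ ∣ N G J′ ∣) (∣p∣≡∣p∩q∣+∣p∩∁q∣ J (N G A)) ⟩
      ∣ X ∣ + ∣ J′ ∣ + ∣ N G J′ ∣    ≡⟨ +-assoc (∣ X ∣) _ _ ⟩
      ∣ X ∣ + (∣ J′ ∣ + ∣ N G J′ ∣)  ≡⟨ +-comm (∣ X ∣) _ ⟩
      ∣ J′ ∣ + ∣ N G J′ ∣ + ∣ X ∣    ∎)

  ∣S∣≤∣J∣+∣S∩Lc∣ : ∀ {S} → Independent G ⊤ S → ∣ S ∣ ≤ ∣ J ∣ + ∣ S ∩ Lc G J ∣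
  ∣S∣≤∣J∣+∣S∩Lc∣ {S} S-independent = begin
    ∣ S ∣                                ≡⟨ ∣p∣≡∣p∩q∣+∣p∩∁q∣ S (Lset G J) ⟩
    ∣ S ∩ Lset G J ∣ + ∣ S ∩ Lc G J ∣    ≤⟨ +-monoˡ-≤ (∣ S ∩ Lc G J ∣) (∣S∩Lset∣≤∣J∣ S-independent) ⟩
    ∣ J ∣ + ∣ S ∩ Lc G J ∣               ∎

  ∈Lc⇒∉J : ∀ {x} → x ∈ Lc G J → x ∉ J
  ∈Lc⇒∉J x∈Lc x∈J = x∈∁p⇒x∉p x∈Lc (x∈p∪q⁺ (inj₁ x∈J))

  ∈Lc⇒∉N[J] : ∀ {x} → x ∈ Lc G J → x ∉ N G J
  ∈Lc⇒∉N[J] x∈Lc x∈NJ = x∈∁p⇒x∉p x∈Lc (x∈p∪q⁺ (inj₂ x∈NJ))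

  ∈Lc⇒nonadjacent : ∀ {x y} → x ∈ Lc G J → y ∈ J → adj G x y ≡ false
  ∈Lc⇒nonadjacent x∈Lc y∈J = ¬-not (∈Lc⇒∉N[J] x∈Lc ∘ ∈N⁺ G y∈J)

  restrict-independent : ∀ {S} → Independent G ⊤ S → Independent G (Lc G J) (S ∩ Lc G J)
  restrict-independent {S} (_ , S-independent) = p∩q⊆q S (Lc G J) , λ x y x∈ y∈ →
    S-independent x y (proj₁ (x∈p∩q⁻ S _ x∈)) (proj₁ (x∈p∩q⁻ S _ y∈))

  extend-independent : ∀ {T} → Independent G (Lc G J) T → Independent G ⊤ (J ∪ T)
  extend-independent {T} (T⊆Lc , T-independent) = (λ _ → ∈⊤) , λ x y x∈ y∈ →
    nonadjacent x y (x∈p∪q⁻ J T x∈) (x∈p∪q⁻ J T y∈)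
    where
    nonadjacent : ∀ x y → x ∈ J ⊎ x ∈ T → y ∈ J ⊎ y ∈ T → adj G x y ≡ false
    nonadjacent x y (inj₁ x∈J) (inj₁ y∈J) = proj₂ (proj₁ J-critical) x y x∈J y∈J
    nonadjacent x y (inj₁ x∈J) (inj₂ y∈T) =
      trans (Graph.sym G x y) (∈Lc⇒nonadjacent (T⊆Lc y∈T) x∈J)
    nonadjacent x y (inj₂ x∈T) (inj₁ y∈J) = ∈Lc⇒nonadjacent (T⊆Lc x∈T) y∈J
    nonadjacent x y (inj₂ x∈T) (inj₂ y∈T) = T-independent x y x∈T y∈T

  ∈J∪T∧∈Lc⇒∈T : ∀ {T x} → x ∈ J ∪ T → x ∈ Lc G J → x ∈ T
  ∈J∪T∧∈Lc⇒∈T {T} x∈J∪T x∈Lc =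
    [ (λ x∈J → contradiction x∈J (∈Lc⇒∉J x∈Lc)) , id ]′ (x∈p∪q⁻ J T x∈J∪T)

  ∣J∣+∣T∣≤∣J∪T∣ : ∀ {T} → T ⊆ Lc G J → ∣ J ∣ + ∣ T ∣ ≤ ∣ J ∪ T ∣
  ∣J∣+∣T∣≤∣J∪T∣ {T} T⊆Lc = disjoint⇒∣p∣+∣q∣≤∣r∣ J∩T-empty (p⊆p∪q T) (q⊆p∪q J T)
    where
    J∩T-empty : Empty (J ∩ T)
    J∩T-empty (x , x∈J∩T) with x∈p∩q⁻ J T x∈J∩T
    ... | x∈J , x∈T = ∈Lc⇒∉J (T⊆Lc x∈T) x∈J

  restrict-maximum : ∀ {S} → MaxIndependent G ⊤ S → MaxIndependent G (Lc G J) (S ∩ Lc G J)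
  restrict-maximum {S} (S-independent , S-maximum) =
    restrict-independent S-independent , λ T T-independent →
      +-cancelˡ-≤ (∣ J ∣) _ _ (begin
        ∣ J ∣ + ∣ T ∣            ≤⟨ ∣J∣+∣T∣≤∣J∪T∣ (proj₁ T-independent) ⟩
        ∣ J ∪ T ∣                ≤⟨ S-maximum (J ∪ T) (extend-independent T-independent) ⟩
        ∣ S ∣                    ≤⟨ ∣S∣≤∣J∣+∣S∩Lc∣ S-independent ⟩
        ∣ J ∣ + ∣ S ∩ Lc G J ∣   ∎)

  extend-maximum : ∀ {T} → MaxIndependent G (Lc G J) T → MaxIndependent G ⊤ (J ∪ T)
  extend-maximum {T} (T-independent , T-maximum) =
    extend-independent T-independent , λ R R-independent → begin
      ∣ R ∣                    ≤⟨ ∣S∣≤∣J∣+∣S∩Lc∣ R-independent ⟩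
      ∣ J ∣ + ∣ R ∩ Lc G J ∣   ≤⟨ +-monoʳ-≤ (∣ J ∣) (T-maximum _ (restrict-independent R-independent)) ⟩
      ∣ J ∣ + ∣ T ∣            ≤⟨ ∣J∣+∣T∣≤∣J∪T∣ (proj₁ T-independent) ⟩
      ∣ J ∪ T ∣                ∎

mainTheorem7 : (G : Graph) (J : Subset (n G)) → MaxCriticalIndependent G J →
    (∀ x → ((InCore G ⊤ x × x ∈ Lc G J) ⇔ InCore G (Lc G J) x))
    × (∀ x → ((InCorona G ⊤ x × x ∈ Lc G J) ⇔ InCorona G (Lc G J) x))
mainTheorem7 G J (J-critical , _) =
  (λ x → mk⇔ (core⇒ x) (core⇐ x)) , (λ x → mk⇔ (corona⇒ x) (corona⇐ x))
  where
  open Critical G J-critical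
  core⇒ : ∀ x → InCore G ⊤ x × x ∈ Lc G J → InCore G (Lc G J) x
  core⇒ x (x∈core , x∈Lc) T T-maximum =
    ∈J∪T∧∈Lc⇒∈T (x∈core (J ∪ T) (extend-maximum T-maximum)) x∈Lc

  core⇐ : ∀ x → InCore G (Lc G J) x → InCore G ⊤ x × x ∈ Lc G J
  core⇐ x x∈core with ∃-maximumIndependent G (Lc G J)
  ... | T , T-maximum =
    (λ S S-maximum → proj₁ (x∈p∩q⁻ S _ (x∈core _ (restrict-maximum S-maximum)))) ,
    proj₁ (proj₁ T-maximum) (x∈core T T-maximum)

  corona⇒ : ∀ x → InCorona G ⊤ x × x ∈ Lc G J → InCorona G (Lc G J) x
  corona⇒ x ((S , S-maximum , x∈S) , x∈Lc) =
    S ∩ Lc G J , restrict-maximum S-maximum , x∈p∩q⁺ (x∈S , x∈Lc)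

  corona⇐ : ∀ x → InCorona G (Lc G J) x → InCorona G ⊤ x × x ∈ Lc G J
  corona⇐ x (T , T-maximum , x∈T) =
    (J ∪ T , extend-maximum T-maximum , x∈p∪q⁺ (inj₂ x∈T)) , proj₁ (proj₁ T-maximum) x∈T
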